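{- Let $0<\epsilon<1$ and $0\le\phi<1-\epsilon$, and consider $k$ distinct columns of $A_n(\phi)$. The orthogonal projection of any one of these columns onto the orthogonal complement of the span of the other $k-1$ columns has Euclidean length at least $\big(\frac{\epsilon^n}{\sqrt{n!}}\big)^k$.
   Context: $A_n(\phi)$ is the $n!\times n!$ matrix whose rows and columns are indexed by permutations $\pi,\sigma$ of $[n]$ and whose entries are $A_{\pi\sigma}=\phi^{I(\pi\sigma^{ -1})}$, where $I(\tau)$ is the number of inversions of $\tau$; equivalently $A_{\pi\sigma}=\phi^{d_{KT}(\pi,\sigma)}$ with $d_{KT}$ the Kendall–Tau distance. -}

module Defs where

open import Level using (Level; suc; _⊔_)
open import Data.Nat as ℕ using (ℕ; zero)
open import Data.Fin as Fin using (Fin; _<?_)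
open import Data.Fin.Properties using () renaming (_≟_ to _≟ᶠ_)
open import Data.Vec as Vec using (Vec; []; _∷_; lookup; toList)
open import Data.List as List using (List; [_]; concatMap; map; allFin; filter; foldr; length)
open import Data.List.Relation.Unary.Unique.Propositional using (Unique)
import Data.List.Relation.Unary.Unique.DecPropositional as UDec
open import Data.Product using (_×_; ∃)
open import Relation.Nullary using (¬_; does)
open import Relation.Binary.Definitions using (Decidable)
open import Relation.Binary.Structures using (IsTotalOrder)
open import Algebra.Bundles using (CommutativeRing)
open import Data.Bool using (Bool; true; false; if_then_else_; _xor_)

record OrderedField (c ℓ₁ ℓ₂ : Level) : Set (suc (c ⊔ ℓ₁ ⊔ ℓ₂)) where
  field
    commutativeRing : CommutativeRing c ℓ₁
  open CommutativeRing commutativeRing public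
  field
    _≤_          : Carrier → Carrier → Set ℓ₂
    isTotalOrder : IsTotalOrder _≈_ _≤_
    +-mono-≤     : ∀ {x y} z → x ≤ y → (x + z) ≤ (y + z)
    *-nonneg     : ∀ {x y} → 0# ≤ x → 0# ≤ y → 0# ≤ (x * y)
    1≉0          : ¬ (1# ≈ 0#)
    inverse      : ∀ x → ¬ (x ≈ 0#) → ∃ λ y → (x * y) ≈ 1#

  _<_ : Carrier → Carrier → Set (ℓ₁ ⊔ ℓ₂)
  x < y = (x ≤ y) × ¬ (x ≈ y)

  _^_ : Carrier → ℕ → Carrier
  x ^ zero    = 1#
  x ^ ℕ.suc n = x * (x ^ n)

  fromℕ : ℕ → Carrier
  fromℕ zero      = 0#
  fromℕ (ℕ.suc n) = 1# + fromℕ n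

  sumL : List Carrier → Carrier
  sumL = foldr _+_ 0#

  sumFin : ∀ {k} → (Fin k → Carrier) → Carrier
  sumFin {k} f = sumL (map f (allFin k))

-- Permutations of [n] = {0,…,n-1}, as one-line notation vectors
-- (σ i = lookup σ i) with pairwise distinct entries.

IsPerm : ∀ {n} → Vec (Fin n) n → Set
IsPerm σ = Unique (toList σ)

isPerm? : ∀ {n} (σ : Vec (Fin n) n) → Relation.Nullary.Dec (IsPerm σ)
isPerm? {n} σ = UDec.unique? (_≟ᶠ_ {n}) (toList σ)

allVecs : (m n : ℕ) → List (Vec (Fin n) m)
allVecs zero      n = [ [] ]
allVecs (ℕ.suc m) n = concatMap (λ x → map (x ∷_) (allVecs m n)) (allFin n)

perms : (n : ℕ) → List (Vec (Fin n) n)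
perms n = filter isPerm? (allVecs n n)

-- Kendall–Tau distance: number of pairs i < j on which π and σ disagree
-- in relative order.  It equals I(π σ⁻¹), the number of inversions.
ltB : ∀ {n} → Fin n → Fin n → Bool
ltB a b = does (a <? b)

dKT : ∀ {n} → Vec (Fin n) n → Vec (Fin n) n → ℕ
dKT {n} π σ =
  length (filter (λ p → Data.Bool._≟_ (f p) true)
    (concatMap (λ i → map (λ j → (i , j)) (allFin n)) (allFin n)))
  where
  open Data.Product using (_,_)
  f : Fin n × Fin n → Bool
  f (i , j) = if ltB i j
              then (ltB (lookup π i) (lookup π j) xor ltB (lookup σ i) (lookup σ j))
              else false

module _ {c ℓ₁ ℓ₂} (F : OrderedField c ℓ₁ ℓ₂) where
  open OrderedField F

  A : (n : ℕ) → Carrier → Vec (Fin n) n → Vec (Fin n) n → Carrier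
  A n φ π σ = φ ^ dKT π σ

  normSq : (n : ℕ) → (Vec (Fin n) n → Carrier) → Carrier
  normSq n v = sumL (map (λ π → v π * v π) (perms n))

  residual : (n : ℕ) (φ : Carrier) {k : ℕ} → (Fin k → Vec (Fin n) n) →
             Fin k → (Fin k → Carrier) → Vec (Fin n) n → Carrier
  residual n φ σ t c π =
    A n φ π (σ t) - sumFin (λ j → if does (j ≟ᶠ t) then 0# else c j * A n φ π (σ j))

-- A_n(φ) is the Gram matrix of a product kernel: A_{πσ} multiplies, over the pairs i < j,
-- a factor φ if π and σ order the pair differently and 1 otherwise, and each factor equals
-- φ + (1 - φ)[same order].  Peeling off one pair therefore writes a quadratic form as φ times
-- itself plus (1 - φ) times the forms of the two classes of points, so for k points that are
-- pairwise separated by some pair the form is at least (1 - φ)^(k-1) times the squared norm of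
-- the coefficients: only a split into two nonempty classes costs a factor 1 - φ, and k points
-- allow at most k - 1 of them.  With coefficient 1 on the chosen column and -a_j on the others,
-- the inner product of the coefficient vector with the residual is this form; distinct
-- permutations disagree on the order of some pair, so Cauchy–Schwarz gives the residual squared
-- norm at least (1 - φ)^(2(k-1)) ≥ ε^(2nk), since 1 - φ > ε.
module Submission where

open import Defs
open import Data.Nat using (ℕ; _!) renaming (_*_ to _*ℕ_)
open import Data.Fin using (Fin)
open import Data.Vec using (Vec)
open import Relation.Binary.PropositionalEquality using (_≡_)

open import Data.Bool using (Bool; true; false; not; _xor_; _∧_; if_then_else_)
open import Data.Bool.Properties using () renaming (_≟_ to _≟ᵇ_)
open import Data.Empty using (⊥-elim)
open import Data.Fin as Fin using (zero; suc; toℕ; fromℕ<; punchOut)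
import Data.Fin.Properties as Finₚ
open import Data.List using (List; []; _∷_; map; filter; length; allFin; concatMap)
open import Data.List.Membership.Propositional using (_∈_; lose)
open import Data.List.Membership.Propositional.Properties
  using (∈-filter⁺; ∈-filter⁻; ∈-map⁺; ∈-map⁻; ∈-concat⁺′; ∈-allFin)
open import Data.List.Properties using (filter-≐; length-filter; length-tabulate; map-∘)
open import Data.List.Relation.Binary.Subset.Propositional using (_⊆_)
open import Data.List.Relation.Unary.All as All using (All; []; _∷_)
open import Data.List.Relation.Unary.All.Properties using (all-filter)
open import Data.List.Relation.Unary.AllPairs as AllPairs using (AllPairs; []; _∷_)
import Data.List.Relation.Unary.AllPairs.Properties as AllPairsₚ
open import Data.List.Relation.Unary.Any using (Any; here; there; any?)
open import Data.List.Relation.Unary.Unique.Propositional using (Unique)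
import Data.List.Relation.Unary.Unique.Propositional.Properties as Uniqueₚ
open import Data.Nat using (zero; suc; z≤n; s≤s)
import Data.Nat as ℕ
import Data.Nat.Properties as ℕₚ
open import Data.Product using (_×_; _,_; proj₁; proj₂; ∃)
open import Data.Sum using (inj₁; inj₂)
open import Data.Vec using ([]; _∷_; lookup; toList; tabulate)
open import Data.Vec.Membership.Propositional.Properties using (∈-lookup; ∈-toList⁺)
open import Data.Vec.Properties using (tabulate∘lookup; tabulate-cong; ≡-dec)
open import Function using (_∘_; _∘′_)
open import Function.Definitions using (Injective)
open import Relation.Binary.Bundles using (Poset)
open import Relation.Binary.Core using (Rel)
open import Relation.Binary.Definitions using (DecidableEquality; tri<; tri≈; tri>)
open import Relation.Binary.PropositionalEquality as ≡ using (_≢_)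
open import Relation.Binary.Structures using (IsTotalOrder)
open import Relation.Nullary using (¬_; Dec; yes; no; does; ¬?)
open import Relation.Nullary.Decidable using (dec-true; dec-false; decidable-stable)
open import Relation.Unary using (Pred; Decidable)

module _ {a p r s} {A : Set a} {P : Pred A p} {R : Rel A r} {S : Rel A s} where

  allPairs-restrict : (∀ {x y} → P x → P y → R x y → S x y) →
                      ∀ {xs} → All P xs → AllPairs R xs → AllPairs S xs
  allPairs-restrict f []         []         = []
  allPairs-restrict f (px ∷ pxs) (rx ∷ rxs) =
    All.zipWith (λ (py , r) → f px py r) (pxs , rx) ∷ allPairs-restrict f pxs rxs

module _ {a} {A : Set a} (G : A → Bool) where

  side : Bool → List A → List A
  side b = filter (λ x → b ≟ᵇ G x)

  length-sides : ∀ xs → length (side true xs) ℕ.+ length (side false xs) ≡ length xs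
  length-sides []       = ≡.refl
  length-sides (x ∷ xs) with G x
  ... | true  = ≡.cong suc (length-sides xs)
  ... | false = ≡.trans (ℕₚ.+-suc _ _) (≡.cong suc (length-sides xs))

  side-[] : ∀ b xs → side b xs ≡ [] → side (not b) xs ≡ xs
  side-[] b     []       _ = ≡.refl
  side-[] true  (x ∷ xs) with G x
  ... | true  = λ ()
  ... | false = ≡.cong (x ∷_) ∘′ side-[] true xs
  side-[] false (x ∷ xs) with G x
  ... | true  = ≡.cong (x ∷_) ∘′ side-[] false xs
  ... | false = λ ()

length-≤-*-nonZero : ∀ {a} {A : Set a} {n k} (xs : List A) → length xs ℕ.≤ k →
                     (∀ {x} → x ∈ xs → ℕ.NonZero n) → length xs ℕ.≤ n *ℕ k
length-≤-*-nonZero []      _     _       = z≤n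
length-≤-*-nonZero {n = n} {k} (_ ∷ _) len≤k nonZero =
  ℕₚ.≤-trans len≤k (ℕₚ.m≤n*m k n {{nonZero (here ≡.refl)}})

module _ {p q} {Pt : Set p} {C : Set q} (bit : Pt → C → Bool) where

  Separates : List C → Pt → Pt → Set q
  Separates L u v = Any (λ s → bit u s ≢ bit v s) L

lookup-injective : ∀ {a} {A : Set a} {m} (xs : Vec A m) → Unique (toList xs) →
                   Injective _≡_ _≡_ (lookup xs)
lookup-injective (x ∷ xs) _          {zero}  {zero}  _  = ≡.refl
lookup-injective (x ∷ xs) (x∉xs ∷ _) {zero}  {suc j} eq =
  ⊥-elim (All.lookup x∉xs (∈-toList⁺ (∈-lookup j xs)) eq)
lookup-injective (x ∷ xs) (x∉xs ∷ _) {suc i} {zero}  eq =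
  ⊥-elim (All.lookup x∉xs (∈-toList⁺ (∈-lookup i xs)) (≡.sym eq))
lookup-injective (x ∷ xs) (_ ∷ u)    {suc i} {suc j} eq = ≡.cong suc (lookup-injective xs u eq)

distinct⇒NonZero : ∀ {a} {A : Set a} {n} {u v : Vec A n} → u ≢ v → ℕ.NonZero n
distinct⇒NonZero {n = zero}  {[]} {[]} u≢v = ⊥-elim (u≢v ≡.refl)
distinct⇒NonZero {n = suc n} _             = _

injective⇒surjective : ∀ {n} {f : Fin n → Fin n} → Injective _≡_ _≡_ f → ∀ y → ∃ λ x → f x ≡ y
injective⇒surjective {suc m} {f} f-injective y with Finₚ.any? (λ x → f x Finₚ.≟ y)
... | yes hit  = hit
... | no  miss = ⊥-elim (ℕₚ.1+n≰n (Finₚ.injective⇒≤ f′-injective))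
  where
  f′ : Fin (suc m) → Fin m
  f′ x = punchOut (miss ∘′ (x ,_) ∘′ ≡.sym)

  f′-injective : Injective _≡_ _≡_ f′
  f′-injective {x} {x′} =
    f-injective ∘′ Finₚ.punchOut-injective (miss ∘′ (x ,_) ∘′ ≡.sym) (miss ∘′ (x′ ,_) ∘′ ≡.sym)

module _ {n} {f g : Fin n → Fin n} (f-injective : Injective _≡_ _≡_ f)
         (reflects : ∀ {a b} → f a Fin.< f b → g a Fin.< g b) where

  order-reflecting⇒≤ : ∀ a → f a Fin.≤ g a
  order-reflecting⇒≤ a = bound (toℕ (f a)) a ≡.refl
    where
    bound : ∀ v a → toℕ (f a) ≡ v → v ℕ.≤ toℕ (g a)
    bound zero    a _      = z≤n
    bound (suc v) a fa≡1+v = ℕₚ.≤-trans (s≤s (bound v b toℕ-fb≡v)) (reflects fb<fa)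
      where
      v<n : v ℕ.< n
      v<n = ℕₚ.<-trans (ℕₚ.n<1+n v) (≡.subst (ℕ._< n) fa≡1+v (Finₚ.toℕ<n (f a)))

      b : Fin n
      b = proj₁ (injective⇒surjective f-injective (fromℕ< v<n))

      toℕ-fb≡v : toℕ (f b) ≡ v
      toℕ-fb≡v = ≡.trans (≡.cong toℕ (proj₂ (injective⇒surjective f-injective (fromℕ< v<n))))
                       (Finₚ.toℕ-fromℕ< v<n)

      fb<fa : f b Fin.< f a
      fb<fa = ≡.subst₂ ℕ._<_ (≡.sym toℕ-fb≡v) (≡.sym fa≡1+v) (ℕₚ.n<1+n v)

pairs : (n : ℕ) → List (Fin n × Fin n)
pairs n = concatMap (λ i → map (λ j → (i , j)) (allFin n)) (allFin n)

∈-pairs : ∀ {n} (p : Fin n × Fin n) → p ∈ pairs n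
∈-pairs {n} (i , j) =
  ∈-concat⁺′ (∈-map⁺ (λ j → (i , j)) (∈-allFin j))
             (∈-map⁺ (λ i → map (λ j → (i , j)) (allFin n)) (∈-allFin i))

increasingOn : ∀ {n} → Vec (Fin n) n → Fin n × Fin n → Bool
increasingOn π (i , j) = ltB i j ∧ ltB (lookup π i) (lookup π j)

-- The local test of dKT, restated so that dKT π σ unfolds to a count of it.
discordant : ∀ {n} → Vec (Fin n) n → Vec (Fin n) n → Fin n × Fin n → Bool
discordant π σ (i , j) =
  if ltB i j then (ltB (lookup π i) (lookup π j) xor ltB (lookup σ i) (lookup σ j)) else false

discordant≡xor : ∀ {n} (π σ : Vec (Fin n) n) p →
                 discordant π σ p ≡ (increasingOn π p xor increasingOn σ p)
discordant≡xor π σ (i , j) with ltB i j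
... | true  = ≡.refl
... | false = ≡.refl

dKT≡count : ∀ {n} (π σ : Vec (Fin n) n) →
            dKT π σ ≡ length (filter (λ p → (increasingOn π p xor increasingOn σ p) ≟ᵇ true) (pairs n))
dKT≡count {n} π σ = ≡.cong length (filter-≐ _ _ (to , from) (pairs n))
  where
  to : ∀ {p} → discordant π σ p ≡ true → (increasingOn π p xor increasingOn σ p) ≡ true
  to {p} = ≡.trans (≡.sym (discordant≡xor π σ p))
  from : ∀ {p} → (increasingOn π p xor increasingOn σ p) ≡ true → discordant π σ p ≡ true
  from {p} = ≡.trans (discordant≡xor π σ p)

does≡true⇒ : ∀ {a} {A : Set a} (a? : Dec A) → does a? ≡ true → A
does≡true⇒ (yes a) _ = a

does≡false⇒¬ : ∀ {a} {A : Set a} (a? : Dec A) → does a? ≡ false → ¬ A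
does≡false⇒¬ (no ¬a) _ = ¬a

increasingOn-< : ∀ {n} (π : Vec (Fin n) n) {i j} → i Fin.< j →
                 increasingOn π (i , j) ≡ ltB (lookup π i) (lookup π j)
increasingOn-< π {i} {j} i<j = ≡.cong (_∧ ltB (lookup π i) (lookup π j)) (dec-true (i Finₚ.<? j) i<j)

module _ {n} (π σ : Vec (Fin n) n) (agree : ∀ p → increasingOn π p ≡ increasingOn σ p) where

  agreement⇒order-reflecting : Injective _≡_ _≡_ (lookup σ) →
                               ∀ {a b} → lookup π a Fin.< lookup π b → lookup σ a Fin.< lookup σ b
  agreement⇒order-reflecting σ-injective {a} {b} πa<πb with Finₚ.<-cmp a b
  ... | tri< a<b _ _ = does≡true⇒ (_ Finₚ.<? _) (begin
    ltB (lookup σ a) (lookup σ b) ≡⟨ increasingOn-< σ a<b ⟨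
    increasingOn σ (a , b)        ≡⟨ agree (a , b) ⟨
    increasingOn π (a , b)        ≡⟨ increasingOn-< π a<b ⟩
    ltB (lookup π a) (lookup π b) ≡⟨ dec-true (_ Finₚ.<? _) πa<πb ⟩
    true                          ∎)
    where open ≡.≡-Reasoning
  ... | tri≈ _ ≡.refl _ = ⊥-elim (Finₚ.<-irrefl ≡.refl πa<πb)
  ... | tri> _ _ b<a  =
    Finₚ.≤∧≢⇒< (ℕₚ.≮⇒≥ σb≮σa) (λ σa≡σb → Finₚ.<-irrefl (σ-injective (≡.sym σa≡σb)) b<a)
    where
    σb≮σa : ¬ lookup σ b Fin.< lookup σ a
    σb≮σa = does≡false⇒¬ (_ Finₚ.<? _) (begin
      ltB (lookup σ b) (lookup σ a) ≡⟨ increasingOn-< σ b<a ⟨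
      increasingOn σ (b , a)        ≡⟨ agree (b , a) ⟨
      increasingOn π (b , a)        ≡⟨ increasingOn-< π b<a ⟩
      ltB (lookup π b) (lookup π a) ≡⟨ dec-false (_ Finₚ.<? _) (Finₚ.<-asym πa<πb) ⟩
      false                         ∎)
      where open ≡.≡-Reasoning

agreement⇒≡ : ∀ {n} {π σ : Vec (Fin n) n} → IsPerm π → IsPerm σ →
              (∀ p → increasingOn π p ≡ increasingOn σ p) → π ≡ σ
agreement⇒≡ {π = π} {σ} π-perm σ-perm agree = begin
  π                   ≡⟨ tabulate∘lookup π ⟨
  tabulate (lookup π) ≡⟨ tabulate-cong lookup-π≗σ ⟩
  tabulate (lookup σ) ≡⟨ tabulate∘lookup σ ⟩
  σ                   ∎
  where
  open ≡.≡-Reasoning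
  π-injective = lookup-injective π π-perm
  σ-injective = lookup-injective σ σ-perm

  lookup-π≗σ : ∀ a → lookup π a ≡ lookup σ a
  lookup-π≗σ a = Finₚ.≤-antisym
    (order-reflecting⇒≤ π-injective (agreement⇒order-reflecting π σ agree σ-injective) a)
    (order-reflecting⇒≤ σ-injective (agreement⇒order-reflecting σ π (λ p → ≡.sym (agree p)) π-injective) a)

distinct-perms-separated : ∀ {n} {π σ : Vec (Fin n) n} → IsPerm π → IsPerm σ → π ≢ σ →
                           Separates increasingOn (pairs n) π σ
distinct-perms-separated {n} {π} {σ} π-perm σ-perm π≢σ =
  decidable-stable (any? (λ p → ¬? (increasingOn π p ≟ᵇ increasingOn σ p)) (pairs n)) λ ¬separated →
    π≢σ (agreement⇒≡ π-perm σ-perm λ p →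
      decidable-stable (_ ≟ᵇ _) (¬separated ∘′ lose (∈-pairs p)))

∈-allVecs : ∀ {m n} (v : Vec (Fin n) m) → v ∈ allVecs m n
∈-allVecs []       = here ≡.refl
∈-allVecs {suc m} {n} (x ∷ v) =
  ∈-concat⁺′ (∈-map⁺ (x ∷_) (∈-allVecs v)) (∈-map⁺ (λ x → map (x ∷_) (allVecs m n)) (∈-allFin x))

perm∈perms : ∀ {n} {σ : Vec (Fin n) n} → IsPerm σ → σ ∈ perms n
perm∈perms {σ = σ} = ∈-filter⁺ isPerm? (∈-allVecs σ)

othersThan : ∀ {k} → Fin k → List (Fin k)
othersThan {k} t = filter (λ j → ¬? (j Finₚ.≟ t)) (allFin k)

length-othersThan-≤ : ∀ {a} {A : Set a} {n k} {σ : Fin k → Vec A n} → (∀ i j → σ i ≡ σ j → i ≡ j) →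
                      ∀ t → length (othersThan t) ℕ.≤ n *ℕ k
length-othersThan-≤ {k = k} {σ} σ-injective t =
  length-≤-*-nonZero (othersThan t) length≤k (distinct⇒NonZero ∘′ σj≢σt)
  where
  length≤k : length (othersThan t) ℕ.≤ k
  length≤k = ℕₚ.≤-trans (length-filter _ (allFin k)) (ℕₚ.≤-reflexive (length-tabulate (λ j → j)))

  σj≢σt : ∀ {j} → j ∈ othersThan t → σ j ≢ σ t
  σj≢σt {j} j∈others =
    proj₂ (∈-filter⁻ (λ j → ¬? (j Finₚ.≟ t)) {xs = allFin k} j∈others) ∘′ σ-injective j t

module OrderedFieldProperties {c ℓ₁ ℓ₂} (F : OrderedField c ℓ₁ ℓ₂) where

  open OrderedField F public hiding (_≤_) renaming (+-mono-≤ to +-monoˡ-≤)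

  -- OrderedField gives _≤_ no fixity; this alias adds one.
  infix 4 _≤_
  _≤_ : Carrier → Carrier → Set ℓ₂
  _≤_ = OrderedField._≤_ F

  open import Algebra.Properties.Ring ring using (-‿distribˡ-*; -‿distribʳ-*; -‿involutive)

  module ≤ = IsTotalOrder isTotalOrder

  poset : Poset c ℓ₁ ℓ₂
  poset = record { isPartialOrder = ≤.isPartialOrder }

  open import Relation.Binary.Reasoning.PartialOrder poset public

  +-monoʳ-≤ : ∀ z {x y} → x ≤ y → z + x ≤ z + y
  +-monoʳ-≤ z {x} {y} x≤y = begin
    z + x ≈⟨ +-comm z x ⟩
    x + z ≤⟨ +-monoˡ-≤ z x≤y ⟩
    y + z ≈⟨ +-comm y z ⟩
    z + y ∎

  +-mono-≤ : ∀ {x y u v} → x ≤ y → u ≤ v → x + u ≤ y + v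
  +-mono-≤ {y = y} {u} x≤y u≤v = ≤.trans (+-monoˡ-≤ u x≤y) (+-monoʳ-≤ y u≤v)

  +-nonNeg : ∀ {x y} → 0# ≤ x → 0# ≤ y → 0# ≤ x + y
  +-nonNeg {x} {y} 0≤x 0≤y = begin
    0#      ≈⟨ +-identityˡ 0# ⟨
    0# + 0# ≤⟨ +-mono-≤ 0≤x 0≤y ⟩
    x + y   ∎

  x-y+y≈x : ∀ x y → x - y + y ≈ x
  x-y+y≈x x y = begin-equality
    x - y + y      ≈⟨ +-assoc x (- y) y ⟩
    x + (- y + y)  ≈⟨ +-congˡ (-‿inverseˡ y) ⟩
    x + 0#         ≈⟨ +-identityʳ x ⟩
    x              ∎

  x≤y⇒0≤y-x : ∀ {x y} → x ≤ y → 0# ≤ y - x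
  x≤y⇒0≤y-x {x} {y} x≤y = begin
    0#    ≈⟨ -‿inverseʳ x ⟨
    x - x ≤⟨ +-monoˡ-≤ (- x) x≤y ⟩
    y - x ∎

  0≤y-x⇒x≤y : ∀ {x y} → 0# ≤ y - x → x ≤ y
  0≤y-x⇒x≤y {x} {y} 0≤y-x = begin
    x          ≈⟨ +-identityˡ x ⟨
    0# + x     ≤⟨ +-monoˡ-≤ x 0≤y-x ⟩
    y - x + x  ≈⟨ x-y+y≈x y x ⟩
    y          ∎

  x-y≤x : ∀ {x y} → 0# ≤ y → x - y ≤ x
  x-y≤x {x} {y} 0≤y = begin
    x - y       ≈⟨ +-identityʳ (x - y) ⟨
    x - y + 0#  ≤⟨ +-monoʳ-≤ (x - y) 0≤y ⟩
    x - y + y   ≈⟨ x-y+y≈x x y ⟩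
    x           ∎

  x≤y-z⇒z≤y-x : ∀ {x y z} → x ≤ y - z → z ≤ y - x
  x≤y-z⇒z≤y-x {x} {y} {z} x≤y-z = 0≤y-x⇒x≤y (begin
    0#              ≤⟨ x≤y⇒0≤y-x x≤y-z ⟩
    y - z - x       ≈⟨ +-assoc y (- z) (- x) ⟩
    y + (- z - x)   ≈⟨ +-congˡ (+-comm (- z) (- x)) ⟩
    y + (- x - z)   ≈⟨ +-assoc y (- x) (- z) ⟨
    y - x - z       ∎)

  +-cancelˡ-≤ : ∀ z {x y} → z + x ≤ z + y → x ≤ y
  +-cancelˡ-≤ z {x} {y} z+x≤z+y = begin
    x            ≈⟨ cancel x ⟨
    - z + (z + x) ≤⟨ +-monoʳ-≤ (- z) z+x≤z+y ⟩
    - z + (z + y) ≈⟨ cancel y ⟩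
    y            ∎
    where
    cancel : ∀ w → - z + (z + w) ≈ w
    cancel w = begin-equality
      - z + (z + w) ≈⟨ +-assoc (- z) z w ⟨
      - z + z + w   ≈⟨ +-congʳ (-‿inverseˡ z) ⟩
      0# + w        ≈⟨ +-identityˡ w ⟩
      w             ∎

  *-monoʳ-≤-nonNeg : ∀ z {x y} → 0# ≤ z → x ≤ y → z * x ≤ z * y
  *-monoʳ-≤-nonNeg z {x} {y} 0≤z x≤y = 0≤y-x⇒x≤y (begin
    0#              ≤⟨ *-nonneg 0≤z (x≤y⇒0≤y-x x≤y) ⟩
    z * (y - x)     ≈⟨ distribˡ z y (- x) ⟩
    z * y + z * - x ≈⟨ +-congˡ (-‿distribʳ-* z x) ⟨
    z * y - z * x   ∎)

  *-monoˡ-≤-nonNeg : ∀ z {x y} → 0# ≤ z → x ≤ y → x * z ≤ y * z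
  *-monoˡ-≤-nonNeg z {x} {y} 0≤z x≤y = begin
    x * z ≈⟨ *-comm x z ⟩
    z * x ≤⟨ *-monoʳ-≤-nonNeg z 0≤z x≤y ⟩
    z * y ≈⟨ *-comm z y ⟩
    y * z ∎

  *-mono-≤-nonNeg : ∀ {x y u v} → 0# ≤ x → 0# ≤ v → x ≤ y → u ≤ v → x * u ≤ y * v
  *-mono-≤-nonNeg {y = y} {u} 0≤x 0≤v x≤y u≤v =
    ≤.trans (*-monoʳ-≤-nonNeg _ 0≤x u≤v) (*-monoˡ-≤-nonNeg _ 0≤v x≤y)

  -x*-x≈x*x : ∀ x → - x * - x ≈ x * x
  -x*-x≈x*x x = begin-equality
    - x * - x    ≈⟨ -‿distribˡ-* x (- x) ⟨
    - (x * - x)  ≈⟨ -‿cong (-‿distribʳ-* x x) ⟨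
    - - (x * x)  ≈⟨ -‿involutive (x * x) ⟩
    x * x        ∎

  x*x-nonNeg : ∀ x → 0# ≤ x * x
  x*x-nonNeg x with ≤.total 0# x
  ... | inj₁ 0≤x = *-nonneg 0≤x 0≤x
  ... | inj₂ x≤0 = begin
    0#        ≤⟨ *-nonneg 0≤-x 0≤-x ⟩
    - x * - x ≈⟨ -x*-x≈x*x x ⟩
    x * x     ∎
    where
    0≤-x : 0# ≤ - x
    0≤-x = ≤.trans (x≤y⇒0≤y-x x≤0) (≤.reflexive (+-identityˡ (- x)))

  0≤1 : 0# ≤ 1#
  0≤1 = ≤.trans (x*x-nonNeg 1#) (≤.reflexive (*-identityʳ 1#))

  fromℕ-nonNeg : ∀ m → 0# ≤ fromℕ m
  fromℕ-nonNeg zero    = ≤.refl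
  fromℕ-nonNeg (suc m) = +-nonNeg 0≤1 (fromℕ-nonNeg m)

  1≤fromℕ : ∀ {m} → 1 ℕ.≤ m → 1# ≤ fromℕ m
  1≤fromℕ {suc m} _ = begin
    1#            ≈⟨ +-identityʳ 1# ⟨
    1# + 0#       ≤⟨ +-monoʳ-≤ 1# (fromℕ-nonNeg m) ⟩
    1# + fromℕ m  ∎

  ^-nonNeg : ∀ {x} → 0# ≤ x → ∀ m → 0# ≤ x ^ m
  ^-nonNeg 0≤x zero    = 0≤1
  ^-nonNeg 0≤x (suc m) = *-nonneg 0≤x (^-nonNeg 0≤x m)

  ^-distribˡ-+-* : ∀ x m n → x ^ (m ℕ.+ n) ≈ x ^ m * x ^ n
  ^-distribˡ-+-* x zero    n = sym (*-identityˡ (x ^ n))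
  ^-distribˡ-+-* x (suc m) n = begin-equality
    x * x ^ (m ℕ.+ n)    ≈⟨ *-congˡ (^-distribˡ-+-* x m n) ⟩
    x * (x ^ m * x ^ n)  ≈⟨ *-assoc x (x ^ m) (x ^ n) ⟨
    x * x ^ m * x ^ n    ∎

  ^-monoˡ-≤ : ∀ {x y} → 0# ≤ x → x ≤ y → ∀ m → x ^ m ≤ y ^ m
  ^-monoˡ-≤ 0≤x x≤y zero    = ≤.refl
  ^-monoˡ-≤ 0≤x x≤y (suc m) =
    *-mono-≤-nonNeg 0≤x (^-nonNeg (≤.trans 0≤x x≤y) m) x≤y (^-monoˡ-≤ 0≤x x≤y m)

  ^≤1 : ∀ {x} → 0# ≤ x → x ≤ 1# → ∀ m → x ^ m ≤ 1#
  ^≤1 0≤x x≤1 zero    = ≤.refl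
  ^≤1 {x} 0≤x x≤1 (suc m) = begin
    x * x ^ m ≤⟨ *-monoʳ-≤-nonNeg x 0≤x (^≤1 0≤x x≤1 m) ⟩
    x * 1#    ≈⟨ *-identityʳ x ⟩
    x         ≤⟨ x≤1 ⟩
    1#        ∎

  ^-antimonoʳ-≤ : ∀ {x} → 0# ≤ x → x ≤ 1# → ∀ {m n} → m ℕ.≤ n → x ^ n ≤ x ^ m
  ^-antimonoʳ-≤ {x} 0≤x x≤1 {m} m≤n with d , ≡.refl ← ℕₚ.m≤n⇒∃[o]m+o≡n m≤n = begin
    x ^ (m ℕ.+ d)  ≈⟨ ^-distribˡ-+-* x m d ⟩
    x ^ m * x ^ d  ≤⟨ *-monoʳ-≤-nonNeg (x ^ m) (^-nonNeg 0≤x m) (^≤1 0≤x x≤1 d) ⟩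
    x ^ m * 1#     ≈⟨ *-identityʳ (x ^ m) ⟩
    x ^ m          ∎

  1≤^ : ∀ {x} → 1# ≤ x → ∀ m → 1# ≤ x ^ m
  1≤^ 1≤x zero    = ≤.refl
  1≤^ {x} 1≤x (suc m) = begin
    1#        ≈⟨ *-identityʳ 1# ⟨
    1# * 1#   ≤⟨ *-mono-≤-nonNeg 0≤1 (≤.trans 0≤1 (1≤^ 1≤x m)) 1≤x (1≤^ 1≤x m) ⟩
    x * x ^ m ∎

  x≤x*y : ∀ {x y} → 0# ≤ x → 1# ≤ y → x ≤ x * y
  x≤x*y {x} {y} 0≤x 1≤y = begin
    x      ≈⟨ *-identityʳ x ⟨
    x * 1# ≤⟨ *-monoʳ-≤-nonNeg x 0≤x 1≤y ⟩
    x * y  ∎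

  x*y+x*y≤x*x+y*y : ∀ x y → x * y + x * y ≤ x * x + y * y
  x*y+x*y≤x*x+y*y x y = begin
    x * y + x * y                        ≈⟨ +-identityˡ _ ⟨
    0# + (x * y + x * y)                 ≤⟨ +-monoˡ-≤ _ (x*x-nonNeg (x - y)) ⟩
    (x - y) * (x - y) + (x * y + x * y)  ≈⟨ expand ⟩
    x * x + - y * - y + (x * - y + x * y) + (x * - y + x * y)
                                         ≈⟨ +-cong (+-cong (+-congˡ (-x*-x≈x*x y)) x*[-y]+x*y≈0) x*[-y]+x*y≈0 ⟩
    x * x + y * y + 0# + 0#              ≈⟨ trans (+-identityʳ _) (+-identityʳ _) ⟩
    x * x + y * y                        ∎
    where
    open import Algebra.Solver.Ring.NaturalCoefficients.Default commutativeSemiring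

    expand : (x - y) * (x - y) + (x * y + x * y) ≈
             x * x + - y * - y + (x * - y + x * y) + (x * - y + x * y)
    expand = solve 3 (λ x n y → (x :+ n) :* (x :+ n) :+ (x :* y :+ x :* y) :=
                                x :* x :+ n :* n :+ (x :* n :+ x :* y) :+ (x :* n :+ x :* y))
                     refl x (- y) y

    x*[-y]+x*y≈0 : x * - y + x * y ≈ 0#
    x*[-y]+x*y≈0 = trans (sym (distribˡ x (- y) y)) (trans (*-congˡ (-‿inverseˡ y)) (zeroʳ x))

module FiniteSums {c ℓ₁ ℓ₂} (F : OrderedField c ℓ₁ ℓ₂) where

  open OrderedFieldProperties F
  open import Algebra.Properties.Ring ring using (-0#≈0#; -‿+-comm)
  open import Algebra.Properties.CommutativeSemigroup +-commutativeSemigroup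
    using () renaming (interchange to +-interchange)
  open import Algebra.Properties.CommutativeSemigroup *-commutativeSemigroup
    using () renaming (interchange to *-interchange)

  sumOver : ∀ {a} {A : Set a} → (A → Carrier) → List A → Carrier
  sumOver f xs = sumL (map f xs)

  module _ {a} {A : Set a} where

    sumOver-cong : ∀ {f g : A → Carrier} → (∀ x → f x ≈ g x) → ∀ xs → sumOver f xs ≈ sumOver g xs
    sumOver-cong f≈g []       = refl
    sumOver-cong f≈g (x ∷ xs) = +-cong (f≈g x) (sumOver-cong f≈g xs)

    sumOver-+ : ∀ (f g : A → Carrier) xs →
                sumOver (λ x → f x + g x) xs ≈ sumOver f xs + sumOver g xs
    sumOver-+ f g []       = sym (+-identityˡ 0#)
    sumOver-+ f g (x ∷ xs) =
      trans (+-congˡ (sumOver-+ f g xs)) (+-interchange (f x) (g x) (sumOver f xs) (sumOver g xs))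

    sumOver-*ˡ : ∀ z (f : A → Carrier) xs → sumOver (λ x → z * f x) xs ≈ z * sumOver f xs
    sumOver-*ˡ z f []       = sym (zeroʳ z)
    sumOver-*ˡ z f (x ∷ xs) = trans (+-congˡ (sumOver-*ˡ z f xs)) (sym (distribˡ z (f x) (sumOver f xs)))

    sumOver-neg : ∀ (f : A → Carrier) xs → sumOver (λ x → - f x) xs ≈ - sumOver f xs
    sumOver-neg f []       = sym -0#≈0#
    sumOver-neg f (x ∷ xs) = trans (+-congˡ (sumOver-neg f xs)) (-‿+-comm (f x) (sumOver f xs))

    sumOver-nonNeg : ∀ {f : A → Carrier} → (∀ x → 0# ≤ f x) → ∀ xs → 0# ≤ sumOver f xs
    sumOver-nonNeg f-nonNeg []       = ≤.refl
    sumOver-nonNeg f-nonNeg (x ∷ xs) = +-nonNeg (f-nonNeg x) (sumOver-nonNeg f-nonNeg xs)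

    sumOver-mono : ∀ {f g : A → Carrier} → (∀ x → f x ≤ g x) → ∀ xs → sumOver f xs ≤ sumOver g xs
    sumOver-mono f≤g []       = ≤.refl
    sumOver-mono f≤g (x ∷ xs) = +-mono-≤ (f≤g x) (sumOver-mono f≤g xs)

    sumOver-filter : ∀ {p} {P : Pred A p} (P? : Decidable P) (f : A → Carrier) xs →
                     sumOver (λ x → if does (P? x) then f x else 0#) xs ≈ sumOver f (filter P? xs)
    sumOver-filter P? f []       = refl
    sumOver-filter P? f (x ∷ xs) with does (P? x)
    ... | true  = +-congˡ (sumOver-filter P? f xs)
    ... | false = trans (+-identityˡ _) (sumOver-filter P? f xs)

    sumOver-partition : ∀ {p} {P : Pred A p} (P? : Decidable P) (f : A → Carrier) xs →
                        sumOver f xs ≈ sumOver f (filter P? xs) + sumOver f (filter (¬? ∘ P?) xs)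
    sumOver-partition P? f xs = begin-equality
      sumOver f xs                                    ≈⟨ sumOver-cong split xs ⟩
      sumOver (λ x → kept x + rejected x) xs          ≈⟨ sumOver-+ kept rejected xs ⟩
      sumOver kept xs + sumOver rejected xs           ≈⟨ +-cong (sumOver-filter P? f xs) (sumOver-filter (¬? ∘ P?) f xs) ⟩
      sumOver f (filter P? xs) + sumOver f (filter (¬? ∘ P?) xs) ∎
      where
      kept rejected : A → Carrier
      kept     x = if does (P? x) then f x else 0#
      rejected x = if not (does (P? x)) then f x else 0#

      split : ∀ x → f x ≈ kept x + rejected x
      split x with does (P? x)
      ... | true  = sym (+-identityʳ (f x))
      ... | false = sym (+-identityˡ (f x))

    sumOver-sides : ∀ (G : A → Bool) (h : A → Bool → Carrier) xs →
                    sumOver (λ x → h x (G x)) xs ≈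
                    sumOver (λ x → h x true) (side G true xs) + sumOver (λ x → h x false) (side G false xs)
    sumOver-sides G h xs = begin-equality
      sumOver (λ x → h x (G x)) xs                    ≈⟨ sumOver-cong split xs ⟩
      sumOver (λ x → onSide true x + onSide false x) xs ≈⟨ sumOver-+ (onSide true) (onSide false) xs ⟩
      sumOver (onSide true) xs + sumOver (onSide false) xs
        ≈⟨ +-cong (sumOver-filter _ _ xs) (sumOver-filter _ _ xs) ⟩
      sumOver (λ x → h x true) (side G true xs) + sumOver (λ x → h x false) (side G false xs) ∎
      where
      onSide : Bool → A → Carrier
      onSide b x = if does (b ≟ᵇ G x) then h x b else 0#

      split : ∀ x → h x (G x) ≈ onSide true x + onSide false x
      split x with G x
      ... | true  = sym (+-identityʳ _)
      ... | false = sym (+-identityˡ _)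

  module _ {a} {A : Set a} (_≟_ : DecidableEquality A) {f : A → Carrier} (f-nonNeg : ∀ x → 0# ≤ f x) where

    sumOver-≤-unique-≡ : ∀ {z xs} → Unique xs → All (_≡ z) xs → sumOver f xs ≤ f z
    sumOver-≤-unique-≡ {z} []          []              = f-nonNeg z
    sumOver-≤-unique-≡ (_ ∷ [])        (≡.refl ∷ [])     = ≤.reflexive (+-identityʳ _)
    sumOver-≤-unique-≡ ((x≢y ∷ _) ∷ _) (≡.refl ∷ ≡.refl ∷ _) = ⊥-elim (x≢y ≡.refl)

    sumOver-mono-⊆ : ∀ ys {xs} → Unique xs → xs ⊆ ys → sumOver f xs ≤ sumOver f ys
    sumOver-mono-⊆ []       {[]}    _ _     = ≤.refl
    sumOver-mono-⊆ []       {x ∷ _} _ xs⊆[] with () ← xs⊆[] (here ≡.refl)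
    sumOver-mono-⊆ (z ∷ ys) {xs}    xs-unique xs⊆z∷ys = begin
      sumOver f xs                                      ≈⟨ sumOver-partition (_≟ z) f xs ⟩
      sumOver f (filter (_≟ z) xs) + sumOver f others   ≤⟨ +-mono-≤ at-most-z rest ⟩
      f z + sumOver f ys                                ∎
      where
      others = filter (¬? ∘ (_≟ z)) xs

      at-most-z : sumOver f (filter (_≟ z) xs) ≤ f z
      at-most-z = sumOver-≤-unique-≡ (Uniqueₚ.filter⁺ (_≟ z) xs-unique) (all-filter (_≟ z) xs)

      others⊆ys : others ⊆ ys
      others⊆ys x∈others with ∈-filter⁻ (¬? ∘ (_≟ z)) x∈others
      ... | x∈xs , x≢z with xs⊆z∷ys x∈xs
      ...   | here x≡z   = ⊥-elim (x≢z x≡z)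
      ...   | there x∈ys = x∈ys

      rest : sumOver f others ≤ sumOver f ys
      rest = sumOver-mono-⊆ ys (Uniqueₚ.filter⁺ (¬? ∘ (_≟ z)) xs-unique) others⊆ys


  dot : ∀ {a} {A : Set a} → (A → Carrier) → (A → Carrier) → List A → Carrier
  dot f g = sumOver (λ x → f x * g x)

  -- Cauchy–Schwarz, with the cross terms bounded termwise by AM–GM: 2ab ≤ a² + b².
  cauchy-schwarz-lowerBound : ∀ {a} {A : Set a} (f g : A → Carrier) xs {κ} → 0# ≤ κ →
                              κ * dot f f xs ≤ dot f g xs → κ * κ * dot f f xs ≤ dot g g xs
  cauchy-schwarz-lowerBound f g xs {κ} 0≤κ κS≤P = +-cancelˡ-≤ (κ * κ * S) (begin
    κ * κ * S + κ * κ * S           ≈⟨ +-cong (*-assoc κ κ S) (*-assoc κ κ S) ⟩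
    κ * (κ * S) + κ * (κ * S)       ≤⟨ +-mono-≤ κκS≤κP κκS≤κP ⟩
    κ * P + κ * P                   ≈⟨ +-cong κP≈ κP≈ ⟨
    dot κf g xs + dot κf g xs       ≈⟨ sumOver-+ _ _ xs ⟨
    sumOver (λ x → κf x * g x + κf x * g x) xs
                                    ≤⟨ sumOver-mono (λ x → x*y+x*y≤x*x+y*y (κf x) (g x)) xs ⟩
    sumOver (λ x → κf x * κf x + g x * g x) xs
                                    ≈⟨ sumOver-+ _ _ xs ⟩
    dot κf κf xs + dot g g xs       ≈⟨ +-congʳ κκS≈ ⟩
    κ * κ * S + dot g g xs          ∎)
    where
    S = dot f f xs
    P = dot f g xs

    κf : _ → Carrier
    κf x = κ * f x

    κκS≤κP : κ * (κ * S) ≤ κ * P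
    κκS≤κP = *-monoʳ-≤-nonNeg κ 0≤κ κS≤P

    κP≈ : dot κf g xs ≈ κ * P
    κP≈ = trans (sumOver-cong (λ x → *-assoc κ (f x) (g x)) xs) (sumOver-*ˡ κ _ xs)

    κκS≈ : dot κf κf xs ≈ κ * κ * S
    κκS≈ = begin-equality
      dot κf κf xs                       ≈⟨ sumOver-cong (λ x → *-interchange κ (f x) κ (f x)) xs ⟩
      sumOver (λ x → κ * κ * (f x * f x)) xs ≈⟨ sumOver-*ˡ (κ * κ) _ xs ⟩
      κ * κ * S                          ∎

module ProductKernel {c ℓ₁ ℓ₂} (F : OrderedField c ℓ₁ ℓ₂) (φ : OrderedField.Carrier F)
                     {p q} {Pt : Set p} {C : Set q} (bit : Pt → C → Bool) where

  open OrderedFieldProperties F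
  open FiniteSums F
  open import Algebra.Properties.CommutativeSemigroup *-commutativeSemigroup
    using () renaming (x∙yz≈y∙xz to x*[y*z]≈y*[x*z])

  ψ : Carrier
  ψ = 1# - φ

  φ*x+ψ*x≈x : ∀ x → φ * x + ψ * x ≈ x
  φ*x+ψ*x≈x x = begin-equality
    φ * x + ψ * x  ≈⟨ distribʳ x φ ψ ⟨
    (φ + ψ) * x    ≈⟨ *-congʳ (trans (+-comm φ ψ) (x-y+y≈x 1# φ)) ⟩
    1# * x         ≈⟨ *-identityˡ x ⟩
    x              ∎

  kernel : List C → Pt → Pt → Carrier
  kernel []      u v = 1#
  kernel (s ∷ L) u v = (if bit u s xor bit v s then φ else 1#) * kernel L u v

  kernel≈^count : ∀ L u v → kernel L u v ≈ φ ^ length (filter (λ s → (bit u s xor bit v s) ≟ᵇ true) L)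
  kernel≈^count []      u v = refl
  kernel≈^count (s ∷ L) u v with bit u s xor bit v s
  ... | true  = *-congˡ (kernel≈^count L u v)
  ... | false = trans (*-identityˡ _) (kernel≈^count L u v)

  factor-split : ∀ a b x → (if a xor b then φ else 1#) * x ≈ φ * x + ψ * (if does (a ≟ᵇ b) then x else 0#)
  factor-split true  true  x = trans (*-identityˡ x) (sym (φ*x+ψ*x≈x x))
  factor-split false false x = trans (*-identityˡ x) (sym (φ*x+ψ*x≈x x))
  factor-split true  false x = sym (trans (+-congˡ (zeroʳ ψ)) (+-identityʳ (φ * x)))
  factor-split false true  x = sym (trans (+-congˡ (zeroʳ ψ)) (+-identityʳ (φ * x)))

  module _ {i} {I : Set i} (u : I → Pt) (c : I → Carrier) where

    bitAt : C → I → Bool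
    bitAt s j = bit (u j) s

    classAt : C → Bool → List I → List I
    classAt s = side (bitAt s)

    Separated : List C → List I → Set _
    Separated L = AllPairs (λ i j → Separates bit L (u i) (u j))

    combination : List C → List I → Pt → Carrier
    combination L xs π = sumOver (λ j → c j * kernel L π (u j)) xs

    quadraticForm : List C → List I → Carrier
    quadraticForm L xs = sumOver (λ i → c i * combination L xs (u i)) xs

    squareSum : List I → Carrier
    squareSum = sumOver (λ i → c i * c i)

    squareSum-nonNeg : ∀ xs → 0# ≤ squareSum xs
    squareSum-nonNeg = sumOver-nonNeg (λ i → x*x-nonNeg (c i))

    combination-∷ : ∀ s L xs π →
                    combination (s ∷ L) xs π ≈
                    φ * combination L xs π + ψ * combination L (classAt s (bit π s) xs) π
    combination-∷ s L xs π = begin-equality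
      combination (s ∷ L) xs π
        ≈⟨ sumOver-cong split xs ⟩
      sumOver (λ j → φ * term j + ψ * agreeing j) xs
        ≈⟨ sumOver-+ _ _ xs ⟩
      sumOver (λ j → φ * term j) xs + sumOver (λ j → ψ * agreeing j) xs
        ≈⟨ +-cong (sumOver-*ˡ φ term xs) (trans (sumOver-*ˡ ψ agreeing xs) (*-congˡ (sumOver-filter _ term xs))) ⟩
      φ * combination L xs π + ψ * combination L (classAt s (bit π s) xs) π ∎
      where
      term agreeing : I → Carrier
      term     j = c j * kernel L π (u j)
      agreeing j = if does (bit π s ≟ᵇ bitAt s j) then term j else 0#

      split : ∀ j → c j * kernel (s ∷ L) π (u j) ≈ φ * term j + ψ * agreeing j
      split j = trans (x*[y*z]≈y*[x*z] (c j) _ _) (factor-split (bit π s) (bitAt s j) (term j))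

    quadraticForm-∷ : ∀ s L xs →
                      quadraticForm (s ∷ L) xs ≈
                      φ * quadraticForm L xs +
                      ψ * (quadraticForm L (classAt s true xs) + quadraticForm L (classAt s false xs))
    quadraticForm-∷ s L xs = begin-equality
      quadraticForm (s ∷ L) xs
        ≈⟨ sumOver-cong split xs ⟩
      sumOver (λ i → φ * (c i * combination L xs (u i)) + ψ * byClass i (bitAt s i)) xs
        ≈⟨ sumOver-+ _ _ xs ⟩
      sumOver (λ i → φ * (c i * combination L xs (u i))) xs + sumOver (λ i → ψ * byClass i (bitAt s i)) xs
        ≈⟨ +-cong (sumOver-*ˡ φ _ xs) (sumOver-*ˡ ψ _ xs) ⟩
      φ * quadraticForm L xs + ψ * sumOver (λ i → byClass i (bitAt s i)) xs
        ≈⟨ +-congˡ (*-congˡ (sumOver-sides (bitAt s) byClass xs)) ⟩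
      φ * quadraticForm L xs +
      ψ * (quadraticForm L (classAt s true xs) + quadraticForm L (classAt s false xs)) ∎
      where
      byClass : I → Bool → Carrier
      byClass i b = c i * combination L (classAt s b xs) (u i)

      split : ∀ i → c i * combination (s ∷ L) xs (u i) ≈
                    φ * (c i * combination L xs (u i)) + ψ * byClass i (bitAt s i)
      split i = begin-equality
        c i * combination (s ∷ L) xs (u i)
          ≈⟨ *-congˡ (combination-∷ s L xs (u i)) ⟩
        c i * (φ * combination L xs (u i) + ψ * combination L (classAt s (bitAt s i) xs) (u i))
          ≈⟨ distribˡ (c i) _ _ ⟩
        c i * (φ * combination L xs (u i)) + c i * (ψ * combination L (classAt s (bitAt s i) xs) (u i))
          ≈⟨ +-cong (x*[y*z]≈y*[x*z] (c i) φ _) (x*[y*z]≈y*[x*z] (c i) ψ _) ⟩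
        φ * (c i * combination L xs (u i)) + ψ * byClass i (bitAt s i) ∎

    quadraticForm-nonNeg : 0# ≤ φ → 0# ≤ ψ → ∀ L xs → 0# ≤ quadraticForm L xs
    quadraticForm-nonNeg _ _ [] xs = begin
      0#                 ≤⟨ x*x-nonNeg total ⟩
      total * total      ≈⟨ *-congˡ (sumOver-cong (λ j → *-identityʳ (c j)) xs) ⟩
      total * sumOver c xs ≈⟨ sumOver-*ˡ total c xs ⟨
      sumOver (λ i → total * c i) xs ≈⟨ sumOver-cong (λ i → *-comm total (c i)) xs ⟩
      quadraticForm [] xs ∎
      where
      total : Carrier
      total = sumOver (λ j → c j * 1#) xs
    quadraticForm-nonNeg 0≤φ 0≤ψ (s ∷ L) xs = begin
      0#  ≤⟨ +-nonNeg (*-nonneg 0≤φ (nonNeg xs))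
                      (*-nonneg 0≤ψ (+-nonNeg (nonNeg (classAt s true xs))
                                              (nonNeg (classAt s false xs)))) ⟩
      _   ≈⟨ quadraticForm-∷ s L xs ⟨
      quadraticForm (s ∷ L) xs ∎
      where
      nonNeg = quadraticForm-nonNeg 0≤φ 0≤ψ L

    separated-side : ∀ s L b xs → Separated (s ∷ L) xs → Separated L (classAt s b xs)
    separated-side s L b xs separated =
      allPairs-restrict drop (all-filter _ xs) (AllPairsₚ.filter⁺ _ separated)
      where
      drop : ∀ {i j} → b ≡ bitAt s i → b ≡ bitAt s j →
             Separates bit (s ∷ L) (u i) (u j) → Separates bit L (u i) (u j)
      drop b≡i b≡j (here i≢j)     = ⊥-elim (i≢j (≡.trans (≡.sym b≡i) b≡j))
      drop _   _   (there sep)    = sep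

    module _ (0≤φ : 0# ≤ φ) (0≤ψ : 0# ≤ ψ) where

      ψ≤1 : ψ ≤ 1#
      ψ≤1 = x-y≤x 0≤φ

      Bounded : List C → List I → Set _
      Bounded L xs = ψ ^ ℕ.pred (length xs) * squareSum xs ≤ quadraticForm L xs

      merge-bounds : ∀ L i ys₁ j ys₀ → Bounded L (i ∷ ys₁) → Bounded L (j ∷ ys₀) →
                     ψ ^ (length ys₁ ℕ.+ suc (length ys₀)) * (squareSum (i ∷ ys₁) + squareSum (j ∷ ys₀)) ≤
                     ψ * (quadraticForm L (i ∷ ys₁) + quadraticForm L (j ∷ ys₀))
      merge-bounds L i ys₁ j ys₀ bounded₁ bounded₀ = begin
        ψ ^ (a ℕ.+ suc b) * (S₁ + S₀)
          ≡⟨ ≡.cong (λ m → ψ ^ m * (S₁ + S₀)) (ℕₚ.+-suc a b) ⟩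
        ψ * ψ ^ (a ℕ.+ b) * (S₁ + S₀)
          ≈⟨ trans (*-assoc ψ _ _) (*-congˡ (distribˡ _ S₁ S₀)) ⟩
        ψ * (ψ ^ (a ℕ.+ b) * S₁ + ψ ^ (a ℕ.+ b) * S₀)
          ≤⟨ *-monoʳ-≤-nonNeg ψ 0≤ψ (+-mono-≤ (shrink (i ∷ ys₁) (ℕₚ.m≤m+n a b))
                                              (shrink (j ∷ ys₀) (ℕₚ.m≤n+m b a))) ⟩
        ψ * (ψ ^ a * S₁ + ψ ^ b * S₀)
          ≤⟨ *-monoʳ-≤-nonNeg ψ 0≤ψ (+-mono-≤ bounded₁ bounded₀) ⟩
        ψ * (quadraticForm L (i ∷ ys₁) + quadraticForm L (j ∷ ys₀)) ∎
        where
        a = length ys₁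
        b = length ys₀
        S₁ = squareSum (i ∷ ys₁)
        S₀ = squareSum (j ∷ ys₀)

        shrink : ∀ ys {m n} → m ℕ.≤ n → ψ ^ n * squareSum ys ≤ ψ ^ m * squareSum ys
        shrink ys m≤n = *-monoˡ-≤-nonNeg _ (squareSum-nonNeg ys) (^-antimonoʳ-≤ 0≤ψ ψ≤1 m≤n)

      quadraticForm-lowerBound : ∀ L xs → Separated L xs → Bounded L xs
      quadraticForm-lowerBound []      []          _                 = ≤.reflexive (zeroʳ 1#)
      quadraticForm-lowerBound []      (i ∷ [])    _                 = ≤.reflexive (begin-equality
        1# * (c i * c i + 0#)       ≈⟨ *-identityˡ _ ⟩
        c i * c i + 0#              ≈⟨ +-congʳ (*-congˡ (*-identityʳ (c i))) ⟨
        c i * (c i * 1#) + 0#       ≈⟨ +-congʳ (*-congˡ (+-identityʳ (c i * 1#))) ⟨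
        c i * (c i * 1# + 0#) + 0#  ∎)
      quadraticForm-lowerBound []      (_ ∷ _ ∷ _) ((() ∷ _) ∷ _)
      quadraticForm-lowerBound (s ∷ L) xs          separated         = begin
        ψ ^ ℕ.pred (length xs) * squareSum xs
          ≤⟨ by-classes (classAt s true xs) (classAt s false xs) ≡.refl ≡.refl (classBound true) (classBound false) ⟩
        φ * Q xs + ψ * (Q (classAt s true xs) + Q (classAt s false xs))
          ≈⟨ quadraticForm-∷ s L xs ⟨
        quadraticForm (s ∷ L) xs ∎
        where
        G = bitAt s
        Q = quadraticForm L

        classBound : ∀ b → Bounded L (classAt s b xs)
        classBound b = quadraticForm-lowerBound L (classAt s b xs) (separated-side s L b xs separated)

        by-classes : ∀ ys₁ ys₀ → classAt s true xs ≡ ys₁ → classAt s false xs ≡ ys₀ →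
                     Bounded L ys₁ → Bounded L ys₀ →
                     ψ ^ ℕ.pred (length xs) * squareSum xs ≤ φ * Q xs + ψ * (Q ys₁ + Q ys₀)
        by-classes [] ys₀ ≡[] ≡ys₀ _ bounded₀ with ≡.trans (≡.sym (side-[] G true xs ≡[])) ≡ys₀
        ... | ≡.refl = begin
          ψ ^ ℕ.pred (length xs) * squareSum xs ≤⟨ bounded₀ ⟩
          Q xs                                  ≈⟨ φ*x+ψ*x≈x (Q xs) ⟨
          φ * Q xs + ψ * Q xs                   ≈⟨ +-congˡ (*-congˡ (+-identityˡ (Q xs))) ⟨
          φ * Q xs + ψ * (0# + Q xs)            ∎
        by-classes (i ∷ ys₁) [] ≡ys₁ ≡[] bounded₁ _ with ≡.trans (≡.sym (side-[] G false xs ≡[])) ≡ys₁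
        ... | ≡.refl = begin
          ψ ^ ℕ.pred (length xs) * squareSum xs ≤⟨ bounded₁ ⟩
          Q xs                                  ≈⟨ φ*x+ψ*x≈x (Q xs) ⟨
          φ * Q xs + ψ * Q xs                   ≈⟨ +-congˡ (*-congˡ (+-identityʳ (Q xs))) ⟨
          φ * Q xs + ψ * (Q xs + 0#)            ∎
        by-classes (i ∷ ys₁) (j ∷ ys₀) ≡ys₁ ≡ys₀ bounded₁ bounded₀ = begin
          ψ ^ ℕ.pred (length xs) * squareSum xs
            ≡⟨ ≡.cong (λ m → ψ ^ ℕ.pred m * squareSum xs) length≡ ⟩
          ψ ^ e * squareSum xs
            ≈⟨ *-congˡ (sumOver-sides G (λ i _ → c i * c i) xs) ⟩
          ψ ^ e * (squareSum (classAt s true xs) + squareSum (classAt s false xs))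
            ≡⟨ ≡.cong₂ (λ l r → ψ ^ e * (squareSum l + squareSum r)) ≡ys₁ ≡ys₀ ⟩
          ψ ^ e * (squareSum (i ∷ ys₁) + squareSum (j ∷ ys₀))
            ≤⟨ merge-bounds L i ys₁ j ys₀ bounded₁ bounded₀ ⟩
          ψ * (Q (i ∷ ys₁) + Q (j ∷ ys₀))
            ≈⟨ +-identityˡ _ ⟨
          0# + ψ * (Q (i ∷ ys₁) + Q (j ∷ ys₀))
            ≤⟨ +-monoˡ-≤ _ (*-nonneg 0≤φ (quadraticForm-nonNeg 0≤φ 0≤ψ L xs)) ⟩
          φ * Q xs + ψ * (Q (i ∷ ys₁) + Q (j ∷ ys₀)) ∎
          where
          e = length ys₁ ℕ.+ suc (length ys₀)

          length≡ : length xs ≡ suc e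
          length≡ = ≡.trans (≡.sym (length-sides G xs)) (≡.cong₂ (λ l r → length l ℕ.+ length r) ≡ys₁ ≡ys₀)

module KendallTauKernel {c ℓ₁ ℓ₂} (F : OrderedField c ℓ₁ ℓ₂) (φ : OrderedField.Carrier F) {n : ℕ} where

  open OrderedFieldProperties F
  open FiniteSums F
  open ProductKernel F φ (increasingOn {n}) public
  open import Algebra.Properties.Ring ring using (-0#≈0#; -‿distribˡ-*)

  A≈kernel : ∀ π σ → A F n φ π σ ≈ kernel (pairs n) π σ
  A≈kernel π σ = begin-equality
    φ ^ dKT π σ
      ≡⟨ ≡.cong (φ ^_) (dKT≡count π σ) ⟩
    φ ^ length (filter (λ p → (increasingOn π p xor increasingOn σ p) ≟ᵇ true) (pairs n))
      ≈⟨ kernel≈^count (pairs n) π σ ⟨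
    kernel (pairs n) π σ ∎

  module _ {k} (t : Fin k) (a : Fin k → Carrier) where

    coefficient : Fin k → Carrier
    coefficient j = if does (j Finₚ.≟ t) then 1# else - a j

    coefficient-t : coefficient t ≡ 1#
    coefficient-t = ≡.cong (if_then 1# else - a t) (dec-true (t Finₚ.≟ t) ≡.refl)

    residual≈combination : ∀ (σ : Fin k → Vec (Fin n) n) π →
                           residual F n φ σ t a π ≈ combination σ coefficient (pairs n) (t ∷ othersThan t) π
    residual≈combination σ π = begin-equality
      residual F n φ σ t a π
        ≈⟨ +-cong (A≈kernel π (σ t)) (sym (sumOver-neg dropped (allFin k))) ⟩
      K (σ t) + sumOver (λ j → - dropped j) (allFin k)
        ≈⟨ +-cong (sym (*-identityˡ (K (σ t)))) (sumOver-cong negated (allFin k)) ⟩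
      1# * K (σ t) + sumOver (λ j → if does (¬? (j Finₚ.≟ t)) then term j else 0#) (allFin k)
        ≈⟨ +-congˡ (sumOver-filter _ term (allFin k)) ⟩
      1# * K (σ t) + sumOver term (othersThan t)
        ≡⟨ ≡.cong (λ x → x * K (σ t) + sumOver term (othersThan t)) coefficient-t ⟨
      combination σ coefficient (pairs n) (t ∷ othersThan t) π ∎
      where
      K = kernel (pairs n) π

      term : Fin k → Carrier
      term j = coefficient j * K (σ j)

      dropped : Fin k → Carrier
      dropped j = if does (j Finₚ.≟ t) then 0# else a j * A F n φ π (σ j)

      negated : ∀ j → - dropped j ≈
                      (if not (does (j Finₚ.≟ t)) then (if does (j Finₚ.≟ t) then 1# else - a j) * K (σ j) else 0#)
      negated j with does (j Finₚ.≟ t)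
      ... | true  = -0#≈0#
      ... | false = trans (-‿distribˡ-* (a j) _) (*-congˡ (A≈kernel π (σ j)))

    module _ (0≤φ : 0# ≤ φ) (0≤ψ : 0# ≤ ψ) {σ : Fin k → Vec (Fin n) n}
             (σ-perm : ∀ j → IsPerm (σ j)) (σ-injective : ∀ i j → σ i ≡ σ j → i ≡ j) where

      residual-lowerBound : ψ ^ length (othersThan t) * ψ ^ length (othersThan t) ≤
                            normSq F n (residual F n φ σ t a)
      residual-lowerBound = begin
        κ * κ                                     ≤⟨ x≤x*y (*-nonneg 0≤κ 0≤κ) 1≤squareSum ⟩
        κ * κ * squareSum σ coefficient columns   ≤⟨ cauchy-schwarz-lowerBound coefficient (R ∘ σ)
                                                                               columns 0≤κ κS≤dot ⟩
        dot (R ∘ σ) (R ∘ σ) columns               ≡⟨ ≡.cong sumL (map-∘ {g = R²} {f = σ} columns) ⟩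
        sumOver R² (map σ columns)                ≤⟨ sumOver-mono-⊆ (≡-dec Finₚ._≟_) (x*x-nonNeg ∘ R)
                                                                   (perms n) images-unique images⊆perms ⟩
        normSq F n R                              ∎
        where
        R = residual F n φ σ t a
        R² = λ π → R π * R π
        columns = t ∷ othersThan t
        κ = ψ ^ length (othersThan t)

        0≤κ : 0# ≤ κ
        0≤κ = ^-nonNeg 0≤ψ (length (othersThan t))

        columns-unique : Unique columns
        columns-unique = All.map (λ j≢t t≡j → j≢t (≡.sym t≡j)) (all-filter _ (allFin k))
                       ∷ Uniqueₚ.filter⁺ _ (Uniqueₚ.allFin⁺ k)

        images-unique : Unique (map σ columns)
        images-unique = Uniqueₚ.map⁺ (λ {i} {j} → σ-injective i j) columns-unique

        images⊆perms : map σ columns ⊆ perms n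
        images⊆perms π∈ with j , _ , ≡.refl ← ∈-map⁻ σ π∈ = perm∈perms (σ-perm j)

        separated : Separated σ coefficient (pairs n) columns
        separated = AllPairs.map
          (λ {i} {j} i≢j → distinct-perms-separated (σ-perm i) (σ-perm j) (i≢j ∘ σ-injective i j))
          columns-unique

        1≤squareSum : 1# ≤ squareSum σ coefficient columns
        1≤squareSum = begin
          1#                   ≈⟨ trans (+-identityʳ (1# * 1#)) (*-identityˡ 1#) ⟨
          1# * 1# + 0#         ≤⟨ +-monoʳ-≤ (1# * 1#) (squareSum-nonNeg σ coefficient (othersThan t)) ⟩
          1# * 1# + rest       ≡⟨ ≡.cong (λ x → x * x + rest) coefficient-t ⟨
          squareSum σ coefficient columns ∎
          where rest = squareSum σ coefficient (othersThan t)

        κS≤dot : κ * squareSum σ coefficient columns ≤ dot coefficient (R ∘ σ) columns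
        κS≤dot = begin
          κ * squareSum σ coefficient columns
            ≤⟨ quadraticForm-lowerBound σ coefficient 0≤φ 0≤ψ (pairs n) columns separated ⟩
          quadraticForm σ coefficient (pairs n) columns
            ≈⟨ sumOver-cong (λ j → *-congˡ (residual≈combination σ (σ j))) columns ⟨
          dot coefficient (R ∘ σ) columns ∎

lemma4p1 : ∀ {c ℓ₁ ℓ₂} (F : OrderedField c ℓ₁ ℓ₂) →
    let open OrderedField F in
    (n k : ℕ) (ε φ : Carrier) →
    0# < ε → ε < 1# → 0# ≤ φ → φ < (1# - ε) →
    (σ : Fin k → Vec (Fin n) n) →
    (∀ j → IsPerm (σ j)) →
    (∀ i j → σ i ≡ σ j → i ≡ j) →
    (t : Fin k) (a : Fin k → Carrier) →
    (ε ^ (2 *ℕ n *ℕ k)) ≤ ((fromℕ (n !) ^ k) * normSq F n (residual F n φ σ t a))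
lemma4p1 F n k ε φ (0≤ε , _) (ε≤1 , _) 0≤φ (φ≤1-ε , _) σ σ-perm σ-injective t a = begin
  ε ^ (2 *ℕ n *ℕ k)               ≤⟨ ^-antimonoʳ-≤ 0≤ε ε≤1 m+m≤2nk ⟩
  ε ^ (m ℕ.+ m)                   ≈⟨ ^-distribˡ-+-* ε m m ⟩
  ε ^ m * ε ^ m                   ≤⟨ *-mono-≤-nonNeg (^-nonNeg 0≤ε m) (^-nonNeg 0≤ψ m) ε^m≤ψ^m ε^m≤ψ^m ⟩
  ψ ^ m * ψ ^ m                   ≤⟨ residual-lowerBound t a 0≤φ 0≤ψ σ-perm σ-injective ⟩
  normSq F n R                    ≤⟨ x≤x*y (sumOver-nonNeg (λ π → x*x-nonNeg (R π)) (perms n))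
                                           (1≤^ (1≤fromℕ (ℕₚ.1≤n! n)) k) ⟩
  normSq F n R * fromℕ (n !) ^ k  ≈⟨ *-comm _ _ ⟩
  fromℕ (n !) ^ k * normSq F n R  ∎
  where
  open OrderedFieldProperties F
  open FiniteSums F
  open KendallTauKernel F φ {n}

  R = residual F n φ σ t a
  m = length (othersThan t)

  ε≤ψ : ε ≤ ψ
  ε≤ψ = x≤y-z⇒z≤y-x φ≤1-ε

  0≤ψ : 0# ≤ ψ
  0≤ψ = ≤.trans 0≤ε ε≤ψ

  ε^m≤ψ^m : ε ^ m ≤ ψ ^ m
  ε^m≤ψ^m = ^-monoˡ-≤ 0≤ε ε≤ψ m

  m+m≤2nk : m ℕ.+ m ℕ.≤ 2 *ℕ n *ℕ k
  m+m≤2nk = ≡.subst (m ℕ.+ m ℕ.≤_) (≡.sym (ℕₚ.*-assoc 2 n k))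
              (ℕₚ.+-mono-≤ m≤nk (ℕₚ.≤-trans m≤nk (ℕₚ.m≤m+n _ 0)))
    where
    m≤nk = length-othersThan-≤ σ-injective t
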